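{- For all tuples of variables $\bar x,\bar y$ with $|\bar x|=|\bar y|$, and any tuple $\bar z$ of $|\bar x|$ distinct variables not occurring in $\bar x\bar y$, the negated inclusion atom $\bar x\not\subseteq\bar y$ is logically equivalent to \[ \exists\bar z\,\big(=\!\!(\bar z)\wedge\Diamond(\bar z=\bar x)\wedge\bar z\neq\bar y\big). \]
   Context: Team semantics: models have domain $\mathrm{dom}(M)$ with at least two elements. A team $X$ over $M$ with domain a finite set of variables $V$ is a set of assignments $s:V\to\mathrm{dom}(M)$. Formulas are in negation normal form, and $M\models_X\phi$ is defined by: for a first-order formula $\alpha$ (in particular the literal-like formulas $\bar z=\bar x$ and $\bar z\neq\bar y$, the latter being the first-order negation of $\bar z=\bar y$), $M\models_X\alpha$ iff every $s\in X$ satisfies $\alpha$ in the Tarskian sense; $M\models_X\psi\wedge\chi$ iff both hold on $X$; $M\models_X\exists\bar z\psi$ (for $\bar z$ of length $n$) iff there is $H:X\to\mathcal P(\mathrm{dom}(M)^n)\setminus\{\emptyset\}$ with $M\models_{X[H/\bar z]}\psi$, where $X[H/\bar z]=\{s[\bar m/\bar z]: s\in X,\bar m\in H(s)\}$. Two formulas are logically equivalent if satisfied by the same teams in all models. Constancy: $M\models_X=\!\!(\bar z)$ iff $s(\bar z)=s'(\bar z)$ for all $s,s'\in X$. Negated inclusion: $M\models_X\bar x\not\subseteq\bar y$ iff there is $s\in X$ such that $s(\bar x)\neq s'(\bar y)$ for all $s'\in X$. Possibility operator: $M\models_X\Diamond\phi$ iff there exists a nonempty $Y\subseteq X$ with $M\models_Y\phi$.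 -}

module Defs where

open import Data.Nat using (ℕ; _≟_)
open import Data.Vec using (Vec; []; _∷_; map)
open import Data.Vec.Relation.Unary.Unique.Propositional using (Unique)
open import Data.Vec.Membership.Propositional using (_∈_)
open import Data.Product using (Σ; ∃; _×_; _,_)
open import Relation.Nullary using (¬_; yes; no)
open import Relation.Binary.PropositionalEquality using (_≡_; _≢_)
open import Function.Bundles using (_⇔_)
open import Level using (Lift)

Var : Set
Var = ℕ

-- An assignment into the domain D (values of variables outside the
-- team's domain are irrelevant for the formulas considered here).
Assign : Set → Set
Assign D = Var → D

Team : Set → Set₁
Team D = Assign D → Set

-- A team property: the semantic content of a formula over domain D.
TeamProp : Set → Set₂
TeamProp D = Team D → Set₁

val : {D : Set} {n : ℕ} → Assign D → Vec Var n → Vec D n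
val s xs = map s xs

upd1 : {D : Set} → Assign D → Var → D → Assign D
upd1 s z m v with v ≟ z
... | yes _ = m
... | no  _ = s v

upd : {D : Set} {n : ℕ} → Assign D → Vec Var n → Vec D n → Assign D
upd s []       []       = s
upd s (z ∷ zs) (m ∷ ms) = upd (upd1 s z m) zs ms

-- Supplement X[H/z̄] = { s[m̄/z̄] : s ∈ X, m̄ ∈ H(s) }
-- (membership taken up to pointwise equality of assignments)
supp : {D : Set} {n : ℕ} → Team D → Vec Var n → (Assign D → Vec D n → Set) → Team D
supp X zs H t = Σ _ λ s → X s × Σ _ λ m → H s m × (∀ v → t v ≡ upd s zs m v)

-- Semantics of first-order (flat) formulas: every assignment satisfies it
FO : {D : Set} → (Assign D → Set) → TeamProp D
FO α X = Lift _ (∀ s → X s → α s)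

eqAt : {D : Set} {n : ℕ} → Vec Var n → Vec Var n → TeamProp D
eqAt zs xs = FO (λ s → val s zs ≡ val s xs)

neqAt : {D : Set} {n : ℕ} → Vec Var n → Vec Var n → TeamProp D
neqAt zs ys = FO (λ s → ¬ (val s zs ≡ val s ys))

_∧ᵗ_ : {D : Set} → TeamProp D → TeamProp D → TeamProp D
(φ ∧ᵗ ψ) X = φ X × ψ X
infixr 6 _∧ᵗ_

-- ∃ z̄ φ  (lax semantics, H(s) a nonempty set of n-tuples)
∃ᵗ : {D : Set} {n : ℕ} → Vec Var n → TeamProp D → TeamProp D
∃ᵗ {D} {n} zs φ X =
  Σ (Assign D → Vec D n → Set) λ H →
    (∀ s → X s → ∃ λ m → H s m) × φ (supp X zs H)

const : {D : Set} {n : ℕ} → Vec Var n → TeamProp D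
const zs X = Lift _ (∀ s s' → X s → X s' → val s zs ≡ val s' zs)

negInc : {D : Set} {n : ℕ} → Vec Var n → Vec Var n → TeamProp D
negInc xs ys X = Lift _ (∃ λ s → X s × (∀ s' → X s' → val s xs ≢ val s' ys))

◇ : {D : Set} → TeamProp D → TeamProp D
◇ {D} φ X = Σ (Team D) λ Y → (∀ s → Y s → X s) × (∃ λ s → Y s) × φ Y

_≡ᵗ_ : {D : Set} → TeamProp D → TeamProp D → Set₁
_≡ᵗ_ {D} φ ψ = (X : Team D) → φ X ⇔ ψ X
infix 4 _≡ᵗ_

_∉_ : {n : ℕ} → Var → Vec Var n → Set
v ∉ xs = ¬ (v ∈ xs)

-- Evaluating ∃z̄ with the constant choice H(s) = {s₀(x̄)}, where s₀ witnesses x̄ ⊈ ȳ, makes z̄ the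
-- constant s₀(x̄): the copy of s₀ alone is a nonempty subteam on which z̄ = x̄, and z̄ ≠ ȳ holds
-- everywhere because s₀(x̄) is none of the values s(ȳ).  Conversely, given H, pick the assignment
-- of the ◇-subteam; it comes from some s₀ ∈ X, and constancy transfers z̄ ≠ ȳ on X[H/z̄] to
-- s₀(x̄) ≠ s(ȳ) for every s ∈ X.  Since z̄ is fresh, updating it leaves the values of x̄ and ȳ intact.
module Submission where

open import Defs
open import Data.Nat using (ℕ; _≟_)
open import Data.Vec using (Vec; []; _∷_)
open import Data.Vec.Properties using (map-cong)
open import Data.Vec.Relation.Unary.All as All using (All; []; _∷_)
open import Data.Vec.Relation.Unary.Any using (here; there)
open import Data.Vec.Relation.Unary.Unique.Propositional using (Unique)
open import Data.Vec.Relation.Unary.AllPairs using (_∷_)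
open import Relation.Binary.PropositionalEquality
  using (_≡_; _≢_; refl; sym; trans; cong₂; module ≡-Reasoning)
open import Relation.Nullary using (yes; no)
open import Data.Product using (Σ; _×_; _,_; proj₁; proj₂)
open import Data.Empty using (⊥-elim)
open import Function.Bundles using (mk⇔)
open import Level using (lift)

upd1-updated : {D : Set} (s : Assign D) (z : Var) (m : D) → upd1 s z m z ≡ m
upd1-updated s z m with z ≟ z
... | yes _ = refl
... | no z≢z = ⊥-elim (z≢z refl)

upd1-other : {D : Set} (s : Assign D) (z : Var) (m : D) {v : Var} → v ≢ z → upd1 s z m v ≡ s v
upd1-other s z m {v} v≢z with v ≟ z
... | yes v≡z = ⊥-elim (v≢z v≡z)
... | no _ = refl

upd-∉ : {D : Set} {n : ℕ} (s : Assign D) (zs : Vec Var n) (ms : Vec D n) {v : Var} →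
        v ∉ zs → upd s zs ms v ≡ s v
upd-∉ s [] [] _ = refl
upd-∉ s (z ∷ zs) (m ∷ ms) v∉ =
  trans (upd-∉ (upd1 s z m) zs ms (λ i → v∉ (there i)))
        (upd1-other s z m (λ v≡z → v∉ (here v≡z)))

val-upd-updated : {D : Set} {n : ℕ} (s : Assign D) (zs : Vec Var n) (ms : Vec D n) →
                  Unique zs → val (upd s zs ms) zs ≡ ms
val-upd-updated s [] [] _ = refl
val-upd-updated s (z ∷ zs) (m ∷ ms) (z∉zs ∷ uq) =
  cong₂ _∷_ (trans (upd-∉ (upd1 s z m) zs ms (λ i → All.lookup z∉zs i refl))
                   (upd1-updated s z m))
            (val-upd-updated (upd1 s z m) zs ms uq)

val-upd1-fresh : {D : Set} {k : ℕ} (s : Assign D) (z : Var) (m : D) (xs : Vec Var k) →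
                 z ∉ xs → val (upd1 s z m) xs ≡ val s xs
val-upd1-fresh s z m [] _ = refl
val-upd1-fresh s z m (x ∷ xs) z∉ =
  cong₂ _∷_ (upd1-other s z m (λ x≡z → z∉ (here (sym x≡z))))
            (val-upd1-fresh s z m xs (λ i → z∉ (there i)))

val-upd-fresh : {D : Set} {n k : ℕ} (s : Assign D) (zs : Vec Var n) (ms : Vec D n)
                (xs : Vec Var k) → All (_∉ xs) zs → val (upd s zs ms) xs ≡ val s xs
val-upd-fresh s [] [] xs _ = refl
val-upd-fresh s (z ∷ zs) (m ∷ ms) xs (z∉ ∷ fresh) =
  trans (val-upd-fresh (upd1 s z m) zs ms xs fresh) (val-upd1-fresh s z m xs z∉)

module _ {D : Set} {n : ℕ} (xs ys zs : Vec Var n) (uq : Unique zs)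
         (fresh-x : All (_∉ xs) zs) (fresh-y : All (_∉ ys) zs) (X : Team D) where

  val-zs : {t s : Assign D} {ms : Vec D n} → (∀ v → t v ≡ upd s zs ms v) → val t zs ≡ ms
  val-zs {t} {s} {ms} t≗ = trans (map-cong t≗ zs) (val-upd-updated s zs ms uq)

  val-xs : {t s : Assign D} {ms : Vec D n} → (∀ v → t v ≡ upd s zs ms v) → val t xs ≡ val s xs
  val-xs {t} {s} {ms} t≗ = trans (map-cong t≗ xs) (val-upd-fresh s zs ms xs fresh-x)

  val-ys : {t s : Assign D} {ms : Vec D n} → (∀ v → t v ≡ upd s zs ms v) → val t ys ≡ val s ys
  val-ys {t} {s} {ms} t≗ = trans (map-cong t≗ ys) (val-upd-fresh s zs ms ys fresh-y)

  negInc⇒∃const◇eq≠ : negInc xs ys X → ∃ᵗ zs (const zs ∧ᵗ ◇ (eqAt zs xs) ∧ᵗ neqAt zs ys) X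
  negInc⇒∃const◇eq≠ (lift (s₀ , s₀∈X , s₀⊈)) =
    H , (λ _ _ → c , refl) , constant , possible , distinct
    where
    c : Vec D n
    c = val s₀ xs

    H : Assign D → Vec D n → Set
    H _ ms = ms ≡ c

    constant : const zs (supp X zs H)
    constant = lift λ { _ _ (_ , _ , _ , refl , t≗) (_ , _ , _ , refl , t'≗) →
                          trans (val-zs t≗) (sym (val-zs t'≗)) }

    copy-of-s₀ : Team D
    copy-of-s₀ t = ∀ v → t v ≡ upd s₀ zs c v

    possible : ◇ (eqAt zs xs) (supp X zs H)
    possible = copy-of-s₀ , (λ _ t≗ → s₀ , s₀∈X , c , refl , t≗) , (upd s₀ zs c , λ _ → refl)
             , lift λ _ t≗ → trans (val-zs t≗) (sym (val-xs t≗))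

    distinct : neqAt zs ys (supp X zs H)
    distinct = lift λ { _ (s , s∈X , _ , refl , t≗) z≡y →
                          s₀⊈ s s∈X (trans (sym (val-zs t≗)) (trans z≡y (val-ys t≗))) }

  ∃const◇eq≠⇒negInc : ∃ᵗ zs (const zs ∧ᵗ ◇ (eqAt zs xs) ∧ᵗ neqAt zs ys) X → negInc xs ys X
  ∃const◇eq≠⇒negInc (H , H-total , lift constant , (Y , Y⊆ , (t₀ , t₀∈Y) , lift z≡x) , lift z≢y)
    with Y⊆ t₀ t₀∈Y
  ... | s₀ , s₀∈X , _ , _ , t₀≗ = lift (s₀ , s₀∈X , s₀⊈)
    where
    s₀⊈ : ∀ s → X s → val s₀ xs ≢ val s ys
    s₀⊈ s s∈X x≡y with H-total s s∈X
    ... | ms , ms∈H = z≢y t t∈supp (begin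
        val t zs   ≡⟨ constant t t₀ t∈supp (Y⊆ t₀ t₀∈Y) ⟩
        val t₀ zs  ≡⟨ z≡x t₀ t₀∈Y ⟩
        val t₀ xs  ≡⟨ val-xs t₀≗ ⟩
        val s₀ xs  ≡⟨ x≡y ⟩
        val s ys   ≡⟨ sym (val-ys {t} (λ _ → refl)) ⟩
        val t ys   ∎)
      where
      open ≡-Reasoning
      t : Assign D
      t = upd s zs ms
      t∈supp : supp X zs H t
      t∈supp = s , s∈X , ms , ms∈H , λ _ → refl

proposition5p3 : (D : Set) → (Σ D λ a → Σ D λ b → a ≢ b) →
    {n : ℕ} (xs ys zs : Vec Var n) →
    Unique zs → All (λ z → z ∉ xs × z ∉ ys) zs →
    negInc {D} xs ys ≡ᵗ ∃ᵗ zs (const zs ∧ᵗ ◇ (eqAt zs xs) ∧ᵗ neqAt zs ys)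
proposition5p3 D _ xs ys zs uq fresh X =
  mk⇔ (negInc⇒∃const◇eq≠ xs ys zs uq fresh-x fresh-y X)
      (∃const◇eq≠⇒negInc xs ys zs uq fresh-x fresh-y X)
  where
  fresh-x = All.map proj₁ fresh
  fresh-y = All.map proj₂ fresh
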